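{- Let $M'=M[D,K]$ be a compatible minor of a weighted uncertainty matroid $\mathcal{M}=(E,\mathcal{I},A,w)$. Let $e\in E(M')$ be a non-trivial element such that (i) $e\in B$ for some minimum-weight basis $B$ of $M'$, (ii) $w_e=U_e$, (iii) $e$ has minimum weight in $E(M')\setminus\mathrm{span}_{M'}(B\setminus\{e\})$, and (iv) $e$ has maximum query cost in $(E(M')\setminus\mathrm{span}_{M'}(B\setminus\{e\}))\cap E^U_{w_e}$. Then $M[D,K\cup\{e\}]$ is a compatible minor of $\mathcal{M}$.
   Context: A weighted uncertainty matroid $\mathcal{M}=(E,\mathcal{I},A,w)$ consists of a matroid $(E,\mathcal{I})$ on a finite set $E$, for each $e$ an uncertainty area $A_e\subseteq\mathbb{R}$ (a non-empty finite union of bounded real intervals, open or closed, single points allowed), and a weight $w_e\in A_e$; $L_e=\inf A_e$, $U_e=\sup A_e$; $e$ is trivial if $A_e=\{w_e\}$. Query costs $c_e\ge 0$, $c(Q)=\sum_{e\in Q}c_e$. An MWB minimizes $\sum_{e\in B}w_e$. A weight assignment consistent with $Q$ is $w^*$ with $w^*_e\in A_e$ for all $e$ and $w^*_e=w_e$ for $e\in Q$. $Q$ verifies the MWB $B$ if for every weight assignment consistent with $Q$, $B$ is an MWB for it. A certificate is a set verifying some MWB; $c^*$ denotes the minimum cost of a certificate of $\mathcal{M}$. For $D,K\subseteq E$, $M[D,K]$ is the matroid obtained from $(E,\mathcal{I})$ by deleting $D$ and contracting $K$; its ground set is $E(M[D,K])=E\setminus(D\cup K)$, elements keep their weights, areas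 and costs, and bases, circuits, span and MWBs of $M'$ refer to this minor with weights $w$; $\mathrm{span}_{M'}(X)=\{e\in E(M'): r'(X\cup\{e\})=r'(X)\}$ with $r'$ the rank function of $M'$. $M[D,K]$ is a compatible minor of $\mathcal{M}$ if there is a certificate of cost $c^*$ verifying an MWB $B$ of $\mathcal{M}$ with $K\subseteq B$ and $D\cap B=\emptyset$. For a real $x$, $E^U_x=\{e\in E: U_e=x \text{ and } e \text{ non-trivial}\}$. -}

module Defs where

open import Level using (0ℓ)
open import Data.Nat as ℕ using (ℕ; zero; suc)
open import Data.Bool using (Bool; true; false; if_then_else_)
open import Data.Fin using (Fin)
import Data.Fin as Fin
open import Data.Fin.Subset as SS using (Subset; _∈_; _∉_; _⊆_; _∪_; _∩_; ∁; ⁅_⁆; ∣_∣; _-_; ⊤)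
open import Data.Vec using (_∷_; [])
open import Data.List using (List)
open import Data.List.Relation.Unary.Any using (Any)
open import Data.Product using (Σ; ∃; _×_; _,_)
open import Data.Empty using () renaming (⊥ to Empty)
open import Relation.Nullary using (¬_)
open import Relation.Binary.PropositionalEquality using (_≡_; _≢_)
open import Algebra.Structures using (IsCommutativeRing)
open import Relation.Binary.Structures using (IsTotalOrder)

-- The real numbers, axiomatised as a (Dedekind-)complete ordered field.
-- (Any two such are isomorphic, so quantifying over all of them is
-- the same as speaking about ℝ.)

record CompleteOrderedField : Set₁ where
  infixl 6 _+_
  infixl 7 _*_
  infix 4 _≤_
  field
    Carrier : Set
    _+_ _*_ : Carrier → Carrier → Carrier
    -_      : Carrier → Carrier
    0# 1#   : Carrier
    isCommutativeRing : IsCommutativeRing _≡_ _+_ _*_ -_ 0# 1#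
    0≢1     : 0# ≢ 1#
    inverse : ∀ x → x ≢ 0# → Σ Carrier (λ y → x * y ≡ 1#)
    _≤_     : Carrier → Carrier → Set
    isTotalOrder : IsTotalOrder _≡_ _≤_
    +-mono-≤ : ∀ {x y} z → x ≤ y → x + z ≤ y + z
    *-nonneg : ∀ {x y} → 0# ≤ x → 0# ≤ y → 0# ≤ x * y
  IsUpperBound : (Carrier → Set) → Carrier → Set
  IsUpperBound S b = ∀ x → S x → x ≤ b
  IsSup : (Carrier → Set) → Carrier → Set
  IsSup S s = IsUpperBound S s × (∀ b → IsUpperBound S b → s ≤ b)
  IsLowerBound : (Carrier → Set) → Carrier → Set
  IsLowerBound S b = ∀ x → S x → b ≤ x
  IsInf : (Carrier → Set) → Carrier → Set
  IsInf S s = IsLowerBound S s × (∀ b → IsLowerBound S b → b ≤ s)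
  field
    complete : ∀ (S : Carrier → Set) → Σ Carrier S → Σ Carrier (IsUpperBound S)
             → Σ Carrier (IsSup S)
  _<_ : Carrier → Carrier → Set
  x < y = x ≤ y × x ≢ y

IsMaximalIn : ∀ {n} → (Subset n → Set) → Subset n → Subset n → Set
IsMaximalIn Ind G B = B ⊆ G × Ind B × (∀ B' → B ⊆ B' → B' ⊆ G → Ind B' → B' ≡ B)

record Matroid (n : ℕ) : Set₁ where
  field
    Indep    : Subset n → Set
    indep-∅  : Indep SS.⊥
    indep-⊆  : ∀ {X Y} → Y ⊆ X → Indep X → Indep Y
    augment  : ∀ {X Y} → Indep X → Indep Y → ∣ X ∣ ℕ.< ∣ Y ∣
             → Σ (Fin n) (λ e → e ∈ Y × e ∉ X × Indep (X ∪ ⁅ e ⁆))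

-- Minors M[D,K] = (M \ D) / K, on ground set E ∖ (D ∪ K).

module _ {n : ℕ} (M : Matroid n) where
  open Matroid M

  groundMinor : Subset n → Subset n → Subset n
  groundMinor D K = ∁ (D ∪ K)

  IndepMinor : Subset n → Subset n → Subset n → Set
  IndepMinor D K I = I ⊆ groundMinor D K
                   × Σ (Subset n) (λ J → IsMaximalIn Indep K J × Indep (I ∪ J))

  IsBasisMinor : Subset n → Subset n → Subset n → Set
  IsBasisMinor D K B = IsMaximalIn (IndepMinor D K) (groundMinor D K) B

  HasRankMinor : Subset n → Subset n → Subset n → ℕ → Set
  HasRankMinor D K X k =
      Σ (Subset n) (λ I → I ⊆ X × IndepMinor D K I × ∣ I ∣ ≡ k)
    × (∀ I → I ⊆ X → IndepMinor D K I → ∣ I ∣ ℕ.≤ k)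

  InSpanMinor : Subset n → Subset n → Subset n → Fin n → Set
  InSpanMinor D K X f = f ∈ groundMinor D K
    × Σ ℕ (λ k → HasRankMinor D K X k × HasRankMinor D K (X ∪ ⁅ f ⁆) k)

module WithReals (R : CompleteOrderedField) where
  open CompleteOrderedField R

  record Interval : Set where
    field
      lo hi : Carrier
      loClosed hiClosed : Bool

  InInterval : Interval → Carrier → Set
  InInterval I x = (if Interval.loClosed I then lo ≤ x else lo < x)
                 × (if Interval.hiClosed I then x ≤ hi else x < hi)
    where open Interval I

  record Area : Set where
    field
      intervals : List Interval
      nonempty  : Σ Carrier (λ x → Any (λ I → InInterval I x) intervals)

  InArea : Area → Carrier → Set
  InArea A x = Any (λ I → InInterval I x) (Area.intervals A)

  sumOver : ∀ {n} → (Fin n → Carrier) → Subset n → Carrier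
  sumOver {zero}  f []      = 0#
  sumOver {suc n} f (b ∷ s) = (if b then f Fin.zero else 0#) + sumOver (λ i → f (Fin.suc i)) s

  record UMatroid (n : ℕ) : Set₁ where
    field
      matroid : Matroid n
      area    : Fin n → Area
      w       : Fin n → Carrier
      w∈A     : ∀ e → InArea (area e) (w e)
      cost    : Fin n → Carrier
      cost≥0  : ∀ e → 0# ≤ cost e

  module _ {n : ℕ} (𝓜 : UMatroid n) where
    open UMatroid 𝓜
    open Matroid matroid

    L U : Fin n → Carrier → Set
    L e = IsInf (InArea (area e))
    U e = IsSup (InArea (area e))

    Trivial : Fin n → Set
    Trivial e = ∀ x → (InArea (area e) x → x ≡ w e) × (x ≡ w e → InArea (area e) x)

    NonTrivial : Fin n → Set
    NonTrivial e = ¬ Trivial e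

    InEU : Carrier → Fin n → Set
    InEU x e = U e x × NonTrivial e

    costOf : Subset n → Carrier
    costOf = sumOver cost

    IsBasis : Subset n → Set
    IsBasis = IsMaximalIn Indep ⊤

    IsMWB : (Fin n → Carrier) → Subset n → Set
    IsMWB w' B = IsBasis B × (∀ B' → IsBasis B' → sumOver w' B ≤ sumOver w' B')

    IsMWBMinor : Subset n → Subset n → Subset n → Set
    IsMWBMinor D K B = IsBasisMinor matroid D K B
      × (∀ B' → IsBasisMinor matroid D K B' → sumOver w B ≤ sumOver w B')

    Consistent : Subset n → (Fin n → Carrier) → Set
    Consistent Q w' = (∀ e → InArea (area e) (w' e)) × (∀ e → e ∈ Q → w' e ≡ w e)

    Verifies : Subset n → Subset n → Set
    Verifies Q B = ∀ w' → Consistent Q w' → IsMWB w' B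

    IsCertificate : Subset n → Set
    IsCertificate Q = Σ (Subset n) (Verifies Q)

    IsOptimalCertificate : Subset n → Set
    IsOptimalCertificate Q = IsCertificate Q × (∀ Q' → IsCertificate Q' → costOf Q ≤ costOf Q')

    Compatible : Subset n → Subset n → Set
    Compatible D K = Σ (Subset n) λ Q → Σ (Subset n) λ B →
      IsOptimalCertificate Q × Verifies Q B × K ⊆ B × (∀ e → e ∈ D → e ∉ B)

module Submission where

-- Let Q be a minimum-cost certificate verifying an MWB Bs with K ⊆ Bs and Bs ∩ D = ∅, and
-- assume e ∉ Bs. Together with K, the elements of Bs spanned by B - e in the minor lie in
-- the closure of (B - e) ∪ K, which misses e; basis exchange therefore yields f ∈ Bs outside
-- K and outside that span with Bs - f + e a basis, and (iii) with the optimality of Bs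
-- gives w f = w e. Then e ∈ Q, for otherwise any value in A_e keeps Bs optimal, forcing
-- A_e = {w e}. If the weight of f is pinned down (f ∈ Q or f trivial), Q itself verifies
-- Bs - f + e. Otherwise f ∈ E^U_{w e}, so by (iv) Q - e + f is no more expensive than Q,
-- and it verifies Bs - f + e, since raising the unknown weight of e to its maximum w e
-- makes Bs - f + e tie with Bs.
-- Excluded middle is not available; completeness of the field supplies what the case
-- distinctions need: ¬ P ⊎ ¬ ¬ P for every P, and stability of equality.

open import Defs
open import Data.Nat using (ℕ)
open import Data.Fin using (Fin)
open import Data.Fin.Subset using (Subset; _∈_; _∪_; ⁅_⁆; _-_)
open import Relation.Nullary using (¬_)

open import Level using (0ℓ)
open import Function using (_∘_; const)
open import Data.Nat as ℕ using (zero; suc)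
import Data.Nat.Properties as ℕₚ
open import Data.Fin using (zero; suc; _≟_)
open import Data.Fin.Subset using (_∉_; _⊆_; _∩_; ∣_∣; ⊤; inside; outside)
open import Data.Fin.Subset.Properties
  using ( _∈?_; ⊆⊤; ⊆-refl; ⊆-trans; ⊆-antisym; p⊆p∪q; q⊆p∪q; x∈p∪q⁻; x∈p∪q⁺
        ; x∈p∩q⁺; x∈p∩q⁻; x∈⁅x⁆; x∈⁅y⁆⇒x≡y; x∈∁p⇒x∉p; x∉p⇒x∈∁p; p─q⊆p
        ; x∈p∧x≢y⇒x∈p-y; ∪-identityʳ; ∪-commutativeMonoid; p─⊥≡p; p⊂q⇒∣p∣<∣q∣; p⊆q⇒∣p∣≤∣q∣; ∣p∣≤∣p∪q∣ )
open import Data.Fin.Properties using (any?)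
open import Data.Vec using (_∷_; []; here; there)
open import Data.Vec.Functional using (updateAt)
open import Data.Vec.Functional.Properties using (updateAt-updates; updateAt-minimal)
open import Data.Product using (∃; _×_; _,_; proj₁; proj₂)
open import Data.Sum using (_⊎_; inj₁; inj₂; [_,_]′; map₂)
open import Relation.Nullary using (yes; no; ¬?; Stable; contradiction)
open import Relation.Nullary.Decidable using (decidable-stable; _×-dec_)
open import Relation.Nullary.Negation using (¬¬-map)
open import Relation.Binary.PropositionalEquality
  using (_≡_; _≢_; refl; sym; trans; cong; cong₂; subst; subst₂; ≢-sym)
open import Relation.Binary.Structures using (IsTotalOrder)
open import Relation.Binary.Bundles using (Poset)
open import Algebra.Bundles using (CommutativeRing; CommutativeMonoid)
import Algebra.Properties.AbelianGroup as AbelianGroupProperties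
import Algebra.Properties.Ring as RingProperties
import Algebra.Definitions.RawMonoid as RawMonoidDefinitions
import Relation.Binary.Reasoning.PartialOrder as PartialOrderReasoning
import Algebra.Properties.CommutativeSemigroup as CommutativeSemigroupProperties

replace : ∀ {n} → Subset n → Fin n → Fin n → Subset n
replace B f e = (B - f) ∪ ⁅ e ⁆

x∉p⇒∣p∪⁅x⁆∣≡1+∣p∣ : ∀ {n} {p : Subset n} {x} → x ∉ p → ∣ p ∪ ⁅ x ⁆ ∣ ≡ suc ∣ p ∣
x∉p⇒∣p∪⁅x⁆∣≡1+∣p∣ {p = inside  ∷ p} {zero}  x∉p = contradiction here x∉p
x∉p⇒∣p∪⁅x⁆∣≡1+∣p∣ {p = outside ∷ p} {zero}  _   = cong (suc ∘ ∣_∣) (∪-identityʳ p)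
x∉p⇒∣p∪⁅x⁆∣≡1+∣p∣ {p = inside  ∷ p} {suc x} x∉p = cong suc (x∉p⇒∣p∪⁅x⁆∣≡1+∣p∣ (x∉p ∘ there))
x∉p⇒∣p∪⁅x⁆∣≡1+∣p∣ {p = outside ∷ p} {suc x} x∉p = x∉p⇒∣p∪⁅x⁆∣≡1+∣p∣ (x∉p ∘ there)

x∈p⇒1+∣p-x∣≡∣p∣ : ∀ {n} {p : Subset n} {x} → x ∈ p → suc ∣ p - x ∣ ≡ ∣ p ∣
x∈p⇒1+∣p-x∣≡∣p∣ {p = inside  ∷ p} here        = cong (suc ∘ ∣_∣) (p─⊥≡p p)
x∈p⇒1+∣p-x∣≡∣p∣ {p = inside  ∷ p} (there x∈p) = cong suc (x∈p⇒1+∣p-x∣≡∣p∣ x∈p)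
x∈p⇒1+∣p-x∣≡∣p∣ {p = outside ∷ p} (there x∈p) = x∈p⇒1+∣p-x∣≡∣p∣ x∈p

p⊆q⊎∃x∈p∖q : ∀ {n} (p q : Subset n) → p ⊆ q ⊎ ∃ λ x → x ∈ p × x ∉ q
p⊆q⊎∃x∈p∖q p q with any? (λ x → x ∈? p ×-dec ¬? (x ∈? q))
... | yes witness = inj₂ witness
... | no none     = inj₁ λ {x} x∈p → decidable-stable (x ∈? q) λ x∉q → none (x , x∈p , x∉q)

p⊆q∧∣q∣≤∣p∣⇒p≡q : ∀ {n} {p q : Subset n} → p ⊆ q → ∣ q ∣ ℕ.≤ ∣ p ∣ → p ≡ q
p⊆q∧∣q∣≤∣p∣⇒p≡q {p = p} {q} p⊆q ∣q∣≤∣p∣ with p⊆q⊎∃x∈p∖q q p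
... | inj₁ q⊆p = ⊆-antisym p⊆q q⊆p
... | inj₂ q⊈p = contradiction ∣q∣≤∣p∣ (ℕₚ.<⇒≱ (p⊂q⇒∣p∣<∣q∣ (p⊆q , q⊈p)))

x∈p∪⁅y⁆⁻ : ∀ {n} {p : Subset n} {x y} → x ∈ p ∪ ⁅ y ⁆ → x ∈ p ⊎ x ≡ y
x∈p∪⁅y⁆⁻ {p = p} {y = y} = map₂ (x∈⁅y⁆⇒x≡y y) ∘ x∈p∪q⁻ p ⁅ y ⁆

x∈p∪⁅x⁆ : ∀ {n} {p : Subset n} {x} → x ∈ p ∪ ⁅ x ⁆
x∈p∪⁅x⁆ {x = x} = x∈p∪q⁺ (inj₂ (x∈⁅x⁆ x))

x∈p-y⇒x≢y : ∀ {n} {p : Subset n} {x y} → x ∈ p - y → x ≢ y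
x∈p-y⇒x≢y {p = inside ∷ p} {zero} () refl
x∈p-y⇒x≢y {p = _ ∷ p} {suc x} {suc y} (there x∈p-y) refl = x∈p-y⇒x≢y x∈p-y refl
x∈p-y⇒x≢y {p = _ ∷ p} {suc x} {zero} _ ()

∪-⊆ : ∀ {n} {p q r : Subset n} → p ⊆ r → q ⊆ r → p ∪ q ⊆ r
∪-⊆ {p = p} {q} p⊆r q⊆r x∈p∪q = [ p⊆r , q⊆r ]′ (x∈p∪q⁻ p q x∈p∪q)

∪⁅⁆-⊆ : ∀ {n} {p q : Subset n} {x} → p ⊆ q → x ∈ q → p ∪ ⁅ x ⁆ ⊆ q
∪⁅⁆-⊆ {q = q} {x} p⊆q x∈q = ∪-⊆ p⊆q λ y∈⁅x⁆ → subst (_∈ q) (sym (x∈⁅y⁆⇒x≡y x y∈⁅x⁆)) x∈q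

⊆-replace : ∀ {n} {p q : Subset n} {y z} → p ⊆ q → y ∉ p → p ∪ ⁅ z ⁆ ⊆ replace q y z
⊆-replace p⊆q y∉p = ∪⁅⁆-⊆ (λ x∈p → p⊆p∪q _ (x∈p∧x≢y⇒x∈p-y (p⊆q x∈p) λ { refl → y∉p x∈p })) x∈p∪⁅x⁆

∉-replace : ∀ {n} {p : Subset n} {x y z} → x ∉ p → x ≢ z → x ∉ replace p y z
∉-replace x∉p x≢z x∈p′ with x∈p∪⁅y⁆⁻ x∈p′
... | inj₁ x∈p-y = x∉p (p─q⊆p _ _ x∈p-y)
... | inj₂ x≡z   = x≢z x≡z

subset-from-⊎ : ∀ {n} {P Q : Fin n → Set} → (∀ i → P i ⊎ Q i)
              → ∃ λ N → (∀ {i} → i ∈ N → Q i) × (∀ {i} → i ∉ N → P i)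
subset-from-⊎ {zero} _ = [] , (λ ()) , λ { {()} }
subset-from-⊎ {suc n} {P} {Q} decide
  with decide zero | subset-from-⊎ {P = P ∘ suc} {Q ∘ suc} (decide ∘ suc)
... | inj₁ p | N , ∈N⇒Q , ∉N⇒P =
  outside ∷ N , (λ { (there i∈N) → ∈N⇒Q i∈N })
              , λ { {zero} _ → p ; {suc i} i∉N → ∉N⇒P (i∉N ∘ there) }
... | inj₂ q | N , ∈N⇒Q , ∉N⇒P =
  inside ∷ N , (λ { here → q ; (there i∈N) → ∈N⇒Q i∈N })
             , λ { {zero} i∉N → contradiction here i∉N ; {suc i} i∉N → ∉N⇒P (i∉N ∘ there) }

module MatroidProperties {n : ℕ} (M : Matroid n) where
  open Matroid M

  IsBasis : Subset n → Set
  IsBasis = IsMaximalIn Indep ⊤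

  ∣indep∣≤∣basis∣ : ∀ {B X} → IsBasis B → Indep X → ∣ X ∣ ℕ.≤ ∣ B ∣
  ∣indep∣≤∣basis∣ (_ , B-indep , B-maximal) X-indep = ℕₚ.≮⇒≥ λ ∣B∣<∣X∣ →
    let (g , _ , g∉B , Bg-indep) = augment B-indep X-indep ∣B∣<∣X∣
    in g∉B (subst (g ∈_) (B-maximal _ (p⊆p∪q ⁅ g ⁆) ⊆⊤ Bg-indep) x∈p∪⁅x⁆)

  basis-of-size : ∀ {B X} → IsBasis B → Indep X → ∣ B ∣ ℕ.≤ ∣ X ∣ → IsBasis X
  basis-of-size B-basis X-indep ∣B∣≤∣X∣ = ⊆⊤ , X-indep , λ Y X⊆Y _ Y-indep →
    sym (p⊆q∧∣q∣≤∣p∣⇒p≡q X⊆Y (ℕₚ.≤-trans (∣indep∣≤∣basis∣ B-basis Y-indep) ∣B∣≤∣X∣))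

  extend : ∀ {Y Z} → Indep Y → Indep Z → ∣ Y ∣ ℕ.≤ ∣ Z ∣
         → ∃ λ T → Y ⊆ T × T ⊆ Y ∪ Z × Indep T × ∣ T ∣ ≡ ∣ Z ∣
  extend {Z = Z} Y-indep Z-indep ∣Y∣≤∣Z∣ = grow _ Y-indep (ℕₚ.m∸n+n≡m ∣Y∣≤∣Z∣)
    where
      grow : ∀ k {Y} → Indep Y → k ℕ.+ ∣ Y ∣ ≡ ∣ Z ∣
           → ∃ λ T → Y ⊆ T × T ⊆ Y ∪ Z × Indep T × ∣ T ∣ ≡ ∣ Z ∣
      grow zero    {Y} Y-indep ∣Y∣≡∣Z∣ = Y , ⊆-refl , p⊆p∪q Z , Y-indep , ∣Y∣≡∣Z∣
      grow (suc k) {Y} Y-indep k+1+∣Y∣≡∣Z∣ =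
        let (g , g∈Z , g∉Y , Yg-indep) =
              augment Y-indep Z-indep (subst (∣ Y ∣ ℕ.<_) k+1+∣Y∣≡∣Z∣ (ℕₚ.m<n+m ∣ Y ∣ ℕ.z<s))
            (T , Yg⊆T , T⊆Yg∪Z , T-indep , ∣T∣≡∣Z∣) =
              grow k Yg-indep (trans (cong (k ℕ.+_) (x∉p⇒∣p∪⁅x⁆∣≡1+∣p∣ g∉Y))
                                     (trans (ℕₚ.+-suc k ∣ Y ∣) k+1+∣Y∣≡∣Z∣))
        in T , ⊆-trans (p⊆p∪q ⁅ g ⁆) Yg⊆T
             , ⊆-trans T⊆Yg∪Z (∪-⊆ (∪⁅⁆-⊆ (p⊆p∪q Z) (q⊆p∪q Y Z g∈Z)) (q⊆p∪q Y Z))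
             , T-indep , ∣T∣≡∣Z∣

  InClosure : Subset n → Fin n → Set
  InClosure A g = g ∉ A → ¬ Indep (A ∪ ⁅ g ⁆)

  ∣⊆closure∣≤∣indep∣ : ∀ {A S} → Indep A → Indep S → (∀ {g} → g ∈ S → InClosure A g)
                     → ∣ S ∣ ℕ.≤ ∣ A ∣
  ∣⊆closure∣≤∣indep∣ A-indep S-indep S⊆clA = ℕₚ.≮⇒≥ λ ∣A∣<∣S∣ →
    let (g , g∈S , g∉A , Ag-indep) = augment A-indep S-indep ∣A∣<∣S∣
    in S⊆clA g∈S g∉A Ag-indep

  -- Extend S within S ∪ A ∪ {e} to the size of A ∪ {e}: the extension contains e, since
  -- A can be augmented from it and no element of S augments A.
  closure-∪⁅⁆-indep : ∀ {A S e} → Indep A → e ∉ A → Indep (A ∪ ⁅ e ⁆) → Indep S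
                    → (∀ {g} → g ∈ S → InClosure A g) → Indep (S ∪ ⁅ e ⁆)
  closure-∪⁅⁆-indep {A} {S} {e} A-indep e∉A Ae-indep S-indep S⊆clA
    with extend S-indep Ae-indep
           (ℕₚ.≤-trans (∣⊆closure∣≤∣indep∣ A-indep S-indep S⊆clA) (∣p∣≤∣p∪q∣ A ⁅ e ⁆))
  ... | T , S⊆T , T⊆S∪Ae , T-indep , ∣T∣≡∣Ae∣ = indep-⊆ (∪⁅⁆-⊆ S⊆T e∈T) T-indep
    where
      ∣A∣<∣T∣ : ∣ A ∣ ℕ.< ∣ T ∣
      ∣A∣<∣T∣ = subst (∣ A ∣ ℕ.<_) (sym (trans ∣T∣≡∣Ae∣ (x∉p⇒∣p∪⁅x⁆∣≡1+∣p∣ e∉A))) (ℕₚ.n<1+n _)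

      outside-A∪e⇒∈S : ∀ {g} → g ∈ T → g ∉ A → g ≢ e → g ∈ S
      outside-A∪e⇒∈S g∈T g∉A g≢e with x∈p∪q⁻ _ _ (T⊆S∪Ae g∈T)
      ... | inj₁ g∈S  = g∈S
      ... | inj₂ g∈Ae with x∈p∪⁅y⁆⁻ g∈Ae
      ...   | inj₁ g∈A = contradiction g∈A g∉A
      ...   | inj₂ g≡e = contradiction g≡e g≢e

      e∈T : e ∈ T
      e∈T = decidable-stable (e ∈? T) λ e∉T →
        let (g , g∈T , g∉A , Ag-indep) = augment A-indep T-indep ∣A∣<∣T∣
        in S⊆clA (outside-A∪e⇒∈S g∈T g∉A λ g≡e → e∉T (subst (_∈ T) g≡e g∈T)) g∉A Ag-indep

  basis-exchange : ∀ {B S e} → IsBasis B → S ⊆ B → e ∉ B → Indep (S ∪ ⁅ e ⁆)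
                 → ∃ λ f → f ∈ B × f ∉ S × IsBasis (replace B f e)
  basis-exchange {B} {S} {e} B-basis@(_ , B-indep , _) S⊆B e∉B Se-indep
    with extend Se-indep B-indep (∣indep∣≤∣basis∣ B-basis Se-indep)
  ... | T , Se⊆T , T⊆Se∪B , T-indep , ∣T∣≡∣B∣ with p⊆q⊎∃x∈p∖q B T
  ...   | inj₁ B⊆T = contradiction (p⊆q⇒∣p∣≤∣q∣ (∪⁅⁆-⊆ B⊆T e∈T)) ∣B∪e∣≰∣T∣
    where
      e∈T : e ∈ T
      e∈T = Se⊆T x∈p∪⁅x⁆
      ∣B∪e∣≰∣T∣ : ¬ (∣ B ∪ ⁅ e ⁆ ∣ ℕ.≤ ∣ T ∣)
      ∣B∪e∣≰∣T∣ rewrite x∉p⇒∣p∪⁅x⁆∣≡1+∣p∣ e∉B | ∣T∣≡∣B∣ = ℕₚ.<-irrefl refl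
  ...   | inj₂ (f , f∈B , f∉T) =
    f , f∈B , f∉T ∘ Se⊆T ∘ x∈p∪q⁺ ∘ inj₁ , basis-of-size B-basis B′-indep (ℕₚ.≤-reflexive (sym ∣B′∣≡∣B∣))
    where
      T⊆B′ : T ⊆ replace B f e
      T⊆B′ {x} x∈T with x∈p∪q⁻ _ _ (T⊆Se∪B x∈T)
      ... | inj₂ x∈B = p⊆p∪q ⁅ e ⁆ (x∈p∧x≢y⇒x∈p-y x∈B λ { refl → f∉T x∈T })
      ... | inj₁ x∈Se with x∈p∪⁅y⁆⁻ x∈Se
      ...   | inj₁ x∈S  = p⊆p∪q ⁅ e ⁆ (x∈p∧x≢y⇒x∈p-y (S⊆B x∈S) λ { refl → f∉T x∈T })
      ...   | inj₂ refl = x∈p∪⁅x⁆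

      ∣B′∣≡∣B∣ : ∣ replace B f e ∣ ≡ ∣ B ∣
      ∣B′∣≡∣B∣ = trans (x∉p⇒∣p∪⁅x⁆∣≡1+∣p∣ (e∉B ∘ p─q⊆p B ⁅ f ⁆)) (x∈p⇒1+∣p-x∣≡∣p∣ f∈B)

      B′-indep : Indep (replace B f e)
      B′-indep = subst Indep (p⊆q∧∣q∣≤∣p∣⇒p≡q T⊆B′ (ℕₚ.≤-reflexive (trans ∣B′∣≡∣B∣ (sym ∣T∣≡∣B∣)))) T-indep

  module _ {D K : Subset n} where

    ∈groundMinor⁻ : ∀ {g} → g ∈ groundMinor M D K → g ∉ D × g ∉ K
    ∈groundMinor⁻ g∈G = x∈∁p⇒x∉p g∈G ∘ x∈p∪q⁺ ∘ inj₁ , x∈∁p⇒x∉p g∈G ∘ x∈p∪q⁺ ∘ inj₂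

    ∈groundMinor⁺ : ∀ {g} → g ∉ D → g ∉ K → g ∈ groundMinor M D K
    ∈groundMinor⁺ g∉D g∉K = x∉p⇒x∈∁p ([ g∉D , g∉K ]′ ∘ x∈p∪q⁻ D K)

    indepMinor⇒indep : ∀ {I} → Indep K → IndepMinor M D K I → Indep (I ∪ K)
    indepMinor⇒indep {I} K-indep (_ , J , (J⊆K , _ , J-maximal) , IJ-indep) =
      subst (Indep ∘ (I ∪_)) (sym (J-maximal K J⊆K ⊆-refl K-indep)) IJ-indep

    indep⇒indepMinor : ∀ {I} → Indep K → I ⊆ groundMinor M D K → Indep (I ∪ K)
                     → IndepMinor M D K I
    indep⇒indepMinor K-indep I⊆G IK-indep =
      I⊆G , K , (⊆-refl , K-indep , λ _ K⊆J J⊆K _ → ⊆-antisym J⊆K K⊆J) , IK-indep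

    indepMinor⇒∉spanMinor : ∀ {X g} → g ∉ X → IndepMinor M D K (X ∪ ⁅ g ⁆)
                          → ¬ InSpanMinor M D K X g
    indepMinor⇒∉spanMinor {X} g∉X Xg-indep (_ , k , ((I , I⊆X , _ , ∣I∣≡k) , _) , (_ , ∣indep∣≤k)) =
      ℕₚ.<-irrefl refl
        (ℕₚ.≤-trans (subst (ℕ._≤ k) (x∉p⇒∣p∪⁅x⁆∣≡1+∣p∣ g∉X) (∣indep∣≤k _ ⊆-refl Xg-indep))
                    (subst (ℕ._≤ ∣ X ∣) ∣I∣≡k (p⊆q⇒∣p∣≤∣q∣ I⊆X)))

    spanMinor⇒inClosure : ∀ {X g} → Indep K → X ⊆ groundMinor M D K → g ∈ groundMinor M D K
                        → ¬ ¬ InSpanMinor M D K X g → InClosure (X ∪ K) g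
    spanMinor⇒inClosure {X} {g} K-indep X⊆G g∈G ¬¬span g∉XK XKg-indep =
      ¬¬span (indepMinor⇒∉spanMinor (g∉XK ∘ x∈p∪q⁺ ∘ inj₁)
               (indep⇒indepMinor K-indep (∪⁅⁆-⊆ X⊆G g∈G)
                 (subst Indep (sym (xy∙z≈xz∙y X ⁅ g ⁆ K)) XKg-indep)))
      where open CommutativeSemigroupProperties
                   (CommutativeMonoid.commutativeSemigroup (∪-commutativeMonoid n))

  -- With N the elements not refuted to lie in the minor span of B - e, the set
  -- K ∪ (Bs ∩ N) lies in the closure of (B - e) ∪ K, and f is exchanged out of Bs avoiding it.
  exchange-outside-spanMinor :
      ((P : Set) → ¬ P ⊎ ¬ ¬ P)
    → ∀ {D K B Bs e} → IsBasis Bs → K ⊆ Bs → (∀ g → g ∈ D → g ∉ Bs)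
    → IsBasisMinor M D K B → e ∈ B → e ∉ Bs
    → ∃ λ f → f ∈ Bs × f ∉ K × ¬ InSpanMinor M D K (B - e) f × IsBasis (replace Bs f e)
  exchange-outside-spanMinor wem {D} {K} {B} {Bs} {e}
    Bs-basis@(_ , Bs-indep , _) K⊆Bs Bs∌D (B⊆G , B-indepMinor , _) e∈B e∉Bs =
    let (N , ∈N⇒¬¬span , ∉N⇒¬span) = subset-from-⊎ (wem ∘ InSpanMinor M D K (B - e))
        (f , f∈Bs , f∉S , exchanged-basis) =
          basis-exchange Bs-basis (S⊆Bs N) e∉Bs
            (closure-∪⁅⁆-indep A-indep e∉A Ae-indep (indep-⊆ (S⊆Bs N) Bs-indep) (S⊆clA ∈N⇒¬¬span))
    in f , f∈Bs , f∉S ∘ x∈p∪q⁺ ∘ inj₁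
         , ∉N⇒¬span (λ f∈N → f∉S (x∈p∪q⁺ (inj₂ (x∈p∩q⁺ (f∈Bs , f∈N)))))
         , exchanged-basis
    where
      A : Subset n
      A = (B - e) ∪ K

      K-indep : Indep K
      K-indep = indep-⊆ K⊆Bs Bs-indep

      B-e⊆G : B - e ⊆ groundMinor M D K
      B-e⊆G = ⊆-trans (p─q⊆p B ⁅ e ⁆) B⊆G

      Ae-indep : Indep (A ∪ ⁅ e ⁆)
      Ae-indep = indep-⊆ (∪⁅⁆-⊆ (∪-⊆ (⊆-trans (p─q⊆p B ⁅ e ⁆) (p⊆p∪q K)) (q⊆p∪q B K))
                                 (x∈p∪q⁺ (inj₁ e∈B)))
                         (indepMinor⇒indep K-indep B-indepMinor)

      A-indep : Indep A
      A-indep = indep-⊆ (p⊆p∪q ⁅ e ⁆) Ae-indep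

      e∉A : e ∉ A
      e∉A = [ (λ e∈B-e → x∈p-y⇒x≢y e∈B-e refl) , proj₂ (∈groundMinor⁻ (B⊆G e∈B)) ]′ ∘ x∈p∪q⁻ _ K

      S⊆Bs : ∀ N → K ∪ (Bs ∩ N) ⊆ Bs
      S⊆Bs N = ∪-⊆ K⊆Bs (proj₁ ∘ x∈p∩q⁻ Bs N)

      S⊆clA : ∀ {N} → (∀ {g} → g ∈ N → ¬ ¬ InSpanMinor M D K (B - e) g)
            → ∀ {g} → g ∈ K ∪ (Bs ∩ N) → InClosure A g
      S⊆clA {N} ∈N⇒¬¬span {g} g∈S g∉A with x∈p∪q⁻ K (Bs ∩ N) g∈S
      ... | inj₁ g∈K  = contradiction (x∈p∪q⁺ (inj₂ g∈K)) g∉A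
      ... | inj₂ g∈Bs∩N =
        let (g∈Bs , g∈N) = x∈p∩q⁻ Bs N g∈Bs∩N
            g∈G = ∈groundMinor⁺ (λ g∈D → Bs∌D g g∈D g∈Bs) (g∉A ∘ x∈p∪q⁺ ∘ inj₂)
        in spanMinor⇒inClosure K-indep B-e⊆G g∈G (∈N⇒¬¬span g∈N) g∉A

module CompleteOrderedFieldProperties (R : CompleteOrderedField) where
  open CompleteOrderedField R renaming (+-mono-≤ to +-monoˡ-≤)
  open IsTotalOrder isTotalOrder public
    using () renaming (refl to ≤-refl; trans to ≤-trans; antisym to ≤-antisym; total to ≤-total)

  commutativeRing : CommutativeRing 0ℓ 0ℓ
  commutativeRing = record { isCommutativeRing = isCommutativeRing }

  open CommutativeRing commutativeRing
    using (+-comm; +-identityˡ; +-identityʳ; -‿inverseˡ; -‿inverseʳ; +-rawMonoid; +-abelianGroup; ring)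
  open AbelianGroupProperties +-abelianGroup using (//-rightDividesˡ; //-rightDividesʳ; ⁻¹-involutive)
  open RingProperties ring using (-1*x≈-x)
  open RawMonoidDefinitions +-rawMonoid using () renaming (_×_ to _·_)

  poset : Poset 0ℓ 0ℓ 0ℓ
  poset = record { isPartialOrder = IsTotalOrder.isPartialOrder isTotalOrder }

  module ≤-Reasoning = PartialOrderReasoning poset

  +-monoʳ-≤ : ∀ c {a b} → a ≤ b → c + a ≤ c + b
  +-monoʳ-≤ c {a} {b} a≤b = subst₂ _≤_ (+-comm a c) (+-comm b c) (+-monoˡ-≤ c a≤b)

  +-cancelʳ-≤ : ∀ c {a b} → a + c ≤ b + c → a ≤ b
  +-cancelʳ-≤ c {a} {b} a+c≤b+c =
    subst₂ _≤_ (//-rightDividesʳ c a) (//-rightDividesʳ c b) (+-monoˡ-≤ (- c) a+c≤b+c)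

  +-cancelˡ-≤ : ∀ c {a b} → c + a ≤ c + b → a ≤ b
  +-cancelˡ-≤ c {a} {b} c+a≤c+b = +-cancelʳ-≤ c (subst₂ _≤_ (+-comm c a) (+-comm c b) c+a≤c+b)

  0≤1 : 0# ≤ 1#
  0≤1 with ≤-total 0# 1#
  ... | inj₁ 0≤1 = 0≤1
  ... | inj₂ 1≤0 = contradiction (≤-antisym 0≤-1*-1 1≤0) 0≢1
    where
      0≤-1 : 0# ≤ - 1#
      0≤-1 = subst₂ _≤_ (-‿inverseʳ 1#) (+-identityˡ (- 1#)) (+-monoˡ-≤ (- 1#) 1≤0)
      0≤-1*-1 : 0# ≤ 1#
      0≤-1*-1 = subst (0# ≤_) (trans (-1*x≈-x (- 1#)) (⁻¹-involutive 1#)) (*-nonneg 0≤-1 0≤-1)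

  1≰0 : ¬ (1# ≤ 0#)
  1≰0 1≤0 = 0≢1 (≤-antisym 0≤1 1≤0)

  -- Completeness gives this much of excluded middle: compare with 0 the supremum of
  -- {-1} ∪ {1 | P}.
  weak-excluded-middle : (P : Set) → ¬ P ⊎ ¬ ¬ P
  weak-excluded-middle P = compare-with-0 (complete S (- 1# , inj₁ refl) (1# , 1-bounds))
    where
      S : Carrier → Set
      S x = x ≡ - 1# ⊎ x ≡ 1# × P

      -1≤1 : - 1# ≤ 1#
      -1≤1 = ≤-trans (subst₂ _≤_ (+-identityˡ (- 1#)) (-‿inverseʳ 1#) (+-monoˡ-≤ (- 1#) 0≤1)) 0≤1

      1-bounds : IsUpperBound S 1#
      1-bounds _ (inj₁ refl)       = -1≤1
      1-bounds _ (inj₂ (refl , _)) = ≤-refl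

      -1-bounds : ¬ P → IsUpperBound S (- 1#)
      -1-bounds _  _ (inj₁ refl)     = ≤-refl
      -1-bounds ¬p _ (inj₂ (_ , p)) = contradiction p ¬p

      compare-with-0 : ∃ (IsSup S) → ¬ P ⊎ ¬ ¬ P
      compare-with-0 (s , s-bounds , s-least) with ≤-total s 0#
      ... | inj₁ s≤0 = inj₁ λ p → 1≰0 (≤-trans (s-bounds 1# (inj₂ (refl , p))) s≤0)
      ... | inj₂ 0≤s = inj₂ λ ¬p →
        1≰0 (subst₂ _≤_ (+-identityˡ 1#) (-‿inverseˡ 1#)
                        (+-monoˡ-≤ 1# (≤-trans 0≤s (s-least (- 1#) (-1-bounds ¬p)))))

  -- Archimedean argument: the multiples of d are bounded by 1 (they would all vanish if
  -- d were 0), and their supremum s has the upper bound s - d.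
  ¬¬≡0⇒≤0 : ∀ {d} → ¬ ¬ (d ≡ 0#) → d ≤ 0#
  ¬¬≡0⇒≤0 {d} ¬¬d≡0 = below-sup (complete Multiple (0# , 0 , refl) (1# , 1-bounds))
    where
      Multiple : Carrier → Set
      Multiple x = ∃ λ k → x ≡ k · d

      ·-zeroʳ : ∀ k → k · 0# ≡ 0#
      ·-zeroʳ zero    = refl
      ·-zeroʳ (suc k) = trans (+-identityˡ (k · 0#)) (·-zeroʳ k)

      1-bounds : IsUpperBound Multiple 1#
      1-bounds _ (k , refl) with ≤-total (k · d) 1#
      ... | inj₁ kd≤1 = kd≤1
      ... | inj₂ 1≤kd = contradiction
        (λ d≡0 → 1≰0 (subst (1# ≤_) (trans (cong (k ·_) d≡0) (·-zeroʳ k)) 1≤kd)) ¬¬d≡0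

      below-sup : ∃ (IsSup Multiple) → d ≤ 0#
      below-sup (s , s-bounds , s-least) =
        +-cancelˡ-≤ s (subst₂ _≤_ refl (sym (+-identityʳ s))
                        (subst (s + d ≤_) (//-rightDividesˡ d s) (+-monoˡ-≤ d s≤s-d)))
        where
          s≤s-d : s ≤ s + - d
          s≤s-d = s-least (s + - d) λ { _ (k , refl) →
            subst₂ _≤_ (trans (cong (_+ - d) (+-comm d (k · d))) (//-rightDividesʳ d (k · d))) refl
                   (+-monoˡ-≤ (- d) (s-bounds (suc k · d) (suc k , refl))) }

  ≡-stable : ∀ {a b} → Stable (a ≡ b)
  ≡-stable {a} {b} ¬¬a≡b = ≤-antisym (¬¬≡⇒≤ ¬¬a≡b) (¬¬≡⇒≤ (¬¬-map sym ¬¬a≡b))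
    where
      ¬¬≡⇒≤ : ∀ {x y} → ¬ ¬ (x ≡ y) → x ≤ y
      ¬¬≡⇒≤ {x} {y} ¬¬x≡y =
        subst₂ _≤_ (//-rightDividesˡ y x) (+-identityˡ y)
          (+-monoˡ-≤ y (¬¬≡0⇒≤0 (¬¬-map (λ { refl → -‿inverseʳ x }) ¬¬x≡y)))

module SumOverProperties (R : CompleteOrderedField) where
  open CompleteOrderedField R using (Carrier; _+_; 0#; _≤_)
  open CompleteOrderedFieldProperties R
  open CommutativeRing commutativeRing using (+-assoc; +-comm; +-identityˡ)
  open WithReals R using (sumOver)

  sumOver-cong : ∀ {n} {f g : Fin n → Carrier} (X : Subset n)
               → (∀ {i} → i ∈ X → f i ≡ g i) → sumOver f X ≡ sumOver g X
  sumOver-cong []            _   = refl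
  sumOver-cong {f = f} {g} (inside ∷ X) f≗g =
    cong₂ _+_ (f≗g here) (sumOver-cong {f = f ∘ suc} {g ∘ suc} X (f≗g ∘ there))
  sumOver-cong {f = f} {g} (outside ∷ X) f≗g =
    cong (0# +_) (sumOver-cong {f = f ∘ suc} {g ∘ suc} X (f≗g ∘ there))

  private
    +-comm-0+ : ∀ a b → a + b ≡ (0# + b) + a
    +-comm-0+ a b = trans (+-comm a b) (cong (_+ a) (sym (+-identityˡ b)))

  sumOver-insert : ∀ {n} (f : Fin n → Carrier) {X i} → i ∉ X → sumOver f (X ∪ ⁅ i ⁆) ≡ sumOver f X + f i
  sumOver-insert f {inside  ∷ X} {zero}  i∉X = contradiction here i∉X
  sumOver-insert f {outside ∷ X} {zero}  _   =
    trans (cong (λ Y → f zero + sumOver (f ∘ suc) Y) (∪-identityʳ X)) (+-comm-0+ (f zero) _)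
  sumOver-insert f {inside  ∷ X} {suc i} i∉X =
    trans (cong (f zero +_) (sumOver-insert (f ∘ suc) (i∉X ∘ there))) (sym (+-assoc _ _ _))
  sumOver-insert f {outside ∷ X} {suc i} i∉X =
    trans (cong (0# +_) (sumOver-insert (f ∘ suc) (i∉X ∘ there))) (sym (+-assoc _ _ _))

  sumOver-remove : ∀ {n} (f : Fin n → Carrier) {X i} → i ∈ X → sumOver f X ≡ sumOver f (X - i) + f i
  sumOver-remove f {inside ∷ X} here =
    trans (+-comm-0+ (f zero) _) (cong (λ Y → (0# + sumOver (f ∘ suc) Y) + f zero) (sym (p─⊥≡p X)))
  sumOver-remove f {_ ∷ X} (there i∈X) =
    trans (cong (_ +_) (sumOver-remove (f ∘ suc) i∈X)) (sym (+-assoc _ _ _))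

  sumOver-replace-≤ : ∀ {n} (v : Fin n → Carrier) {X i j} → i ∈ X → j ∉ X → v j ≤ v i
                    → sumOver v (replace X i j) ≤ sumOver v X
  sumOver-replace-≤ v {X} {i} {j} i∈X j∉X vj≤vi = begin
    sumOver v (replace X i j)  ≡⟨ sumOver-insert v (j∉X ∘ p─q⊆p X ⁅ i ⁆) ⟩
    sumOver v (X - i) + v j    ≤⟨ +-monoʳ-≤ _ vj≤vi ⟩
    sumOver v (X - i) + v i    ≡⟨ sumOver-remove v i∈X ⟨
    sumOver v X                ∎
    where open ≤-Reasoning

module UMatroidProperties (R : CompleteOrderedField) {n : ℕ} (𝓜 : WithReals.UMatroid R n) where
  open CompleteOrderedField R renaming (+-mono-≤ to +-monoˡ-≤)
  open CompleteOrderedFieldProperties R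
  open SumOverProperties R
  open WithReals R hiding (IsBasis)
  open UMatroid 𝓜
  open MatroidProperties matroid using (IsBasis)

  IsMWB-lower : ∀ {v v′ B i} → IsMWB 𝓜 v B → i ∈ B → v′ i ≤ v i → (∀ j → j ≢ i → v′ j ≡ v j)
              → IsMWB 𝓜 v′ B
  IsMWB-lower {v} {v′} {B} {i} (B-basis , B-minimal) i∈B v′i≤vi agree = B-basis , minimal
    where
      open ≤-Reasoning

      agree-outside : ∀ {X} → i ∉ X → sumOver v′ X ≡ sumOver v X
      agree-outside {X} i∉X = sumOver-cong X λ j∈X → agree _ λ { refl → i∉X j∈X }

      i∉-i : ∀ {X} → i ∉ X - i
      i∉-i i∈X-i = x∈p-y⇒x≢y i∈X-i refl

      minimal : ∀ X → IsBasis X → sumOver v′ B ≤ sumOver v′ X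
      minimal X X-basis with i ∈? X
      ... | yes i∈X = begin
        sumOver v′ B             ≡⟨ sumOver-remove v′ i∈B ⟩
        sumOver v′ (B - i) + v′ i ≤⟨ +-monoˡ-≤ (v′ i) B-i≤X-i ⟩
        sumOver v′ (X - i) + v′ i ≡⟨ sumOver-remove v′ i∈X ⟨
        sumOver v′ X             ∎
        where
          B-i≤X-i : sumOver v′ (B - i) ≤ sumOver v′ (X - i)
          B-i≤X-i = subst₂ _≤_ (sym (agree-outside i∉-i)) (sym (agree-outside i∉-i))
            (+-cancelʳ-≤ (v i) (subst₂ _≤_ (sumOver-remove v i∈B) (sumOver-remove v i∈X)
                                          (B-minimal X X-basis)))
      ... | no i∉X = begin
        sumOver v′ B             ≡⟨ sumOver-remove v′ i∈B ⟩
        sumOver v′ (B - i) + v′ i ≤⟨ +-monoʳ-≤ _ v′i≤vi ⟩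
        sumOver v′ (B - i) + v i  ≡⟨ cong (_+ v i) (agree-outside i∉-i) ⟩
        sumOver v (B - i) + v i   ≡⟨ sumOver-remove v i∈B ⟨
        sumOver v B              ≤⟨ B-minimal X X-basis ⟩
        sumOver v X              ≡⟨ agree-outside i∉X ⟨
        sumOver v′ X             ∎

  w-consistent : ∀ {Q} → Consistent 𝓜 Q w
  w-consistent = w∈A , λ _ _ → refl

  consistent-⊆ : ∀ {Q Q′ v} → Q′ ⊆ Q → Consistent 𝓜 Q v → Consistent 𝓜 Q′ v
  consistent-⊆ Q′⊆Q (v∈A , v-fixed) = v∈A , λ j j∈Q′ → v-fixed j (Q′⊆Q j∈Q′)

  consistent-updateAt : ∀ {Q v i x} → Consistent 𝓜 (Q - i) v → InArea (area i) x
                      → (i ∈ Q → x ≡ w i) → Consistent 𝓜 Q (updateAt v i (const x))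
  consistent-updateAt {Q} {v} {i} {x} (v∈A , v-fixed) x∈A x-fixed = in-area , fixed
    where
      in-area : ∀ j → InArea (area j) (updateAt v i (const x) j)
      in-area j with j ≟ i
      ... | yes refl = subst (InArea (area i)) (sym (updateAt-updates i v)) x∈A
      ... | no j≢i   = subst (InArea (area j)) (sym (updateAt-minimal j i v j≢i)) (v∈A j)

      fixed : ∀ j → j ∈ Q → updateAt v i (const x) j ≡ w j
      fixed j j∈Q with j ≟ i
      ... | yes refl = trans (updateAt-updates i v) (x-fixed j∈Q)
      ... | no j≢i   = trans (updateAt-minimal j i v j≢i) (v-fixed j (x∈p∧x≢y⇒x∈p-y j∈Q j≢i))

  determined : ∀ {Q v i} → i ∈ Q ⊎ ¬ ¬ Trivial 𝓜 i → Consistent 𝓜 Q v → v i ≡ w i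
  determined (inj₁ i∈Q)         (_ , v-fixed) = v-fixed _ i∈Q
  determined {i = i} (inj₂ ¬¬i-trivial) (v∈A , _) =
    ≡-stable (¬¬-map (λ i-trivial → proj₁ (i-trivial _) (v∈A i)) ¬¬i-trivial)

  bounded⇒trivial : ∀ {i} → IsUpperBound (InArea (area i)) (w i) → IsLowerBound (InArea (area i)) (w i)
                  → Trivial 𝓜 i
  bounded⇒trivial {i} w-upper w-lower x =
    (λ x∈A → ≤-antisym (w-upper x x∈A) (w-lower x x∈A)) , λ { refl → w∈A i }

  module Exchange {Bs f e} (f∈Bs : f ∈ Bs) (e∉Bs : e ∉ Bs) (exchanged-basis : IsBasis (replace Bs f e)) where

    f≢e : f ≢ e
    f≢e refl = e∉Bs f∈Bs

    sumOver-exchanged : ∀ v → sumOver v (replace Bs f e) ≡ sumOver v (Bs - f) + v e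
    sumOver-exchanged v = sumOver-insert v (e∉Bs ∘ p─q⊆p Bs ⁅ f ⁆)

    IsMWB⇒≤ : ∀ {v} → IsMWB 𝓜 v Bs → v f ≤ v e
    IsMWB⇒≤ {v} (_ , Bs-minimal) = +-cancelˡ-≤ (sumOver v (Bs - f))
      (subst₂ _≤_ (sumOver-remove v f∈Bs) (sumOver-exchanged v) (Bs-minimal _ exchanged-basis))

    IsMWB-tie : ∀ {v} → IsMWB 𝓜 v Bs → v f ≡ v e → IsMWB 𝓜 v (replace Bs f e)
    IsMWB-tie {v} (_ , Bs-minimal) vf≡ve = exchanged-basis , λ X X-basis → begin
      sumOver v (replace Bs f e)  ≡⟨ sumOver-exchanged v ⟩
      sumOver v (Bs - f) + v e    ≡⟨ cong (sumOver v (Bs - f) +_) vf≡ve ⟨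
      sumOver v (Bs - f) + v f    ≡⟨ sumOver-remove v f∈Bs ⟨
      sumOver v Bs                ≤⟨ Bs-minimal X X-basis ⟩
      sumOver v X                 ∎
      where open ≤-Reasoning

    module Certified {Q} (Q-verifies : Verifies 𝓜 Q Bs) where

      consistent⇒≤ : ∀ {v} → Consistent 𝓜 Q v → v f ≤ v e
      consistent⇒≤ v-consistent = IsMWB⇒≤ (Q-verifies _ v-consistent)

      ∉Q⇒lowerBound : e ∉ Q → IsLowerBound (InArea (area e)) (w f)
      ∉Q⇒lowerBound e∉Q x x∈A =
        subst₂ _≤_ (updateAt-minimal f e w f≢e) (updateAt-updates e w)
          (consistent⇒≤ (consistent-updateAt w-consistent x∈A (λ e∈Q → contradiction e∈Q e∉Q)))

      ∉Q⇒upperBound : f ∉ Q → IsUpperBound (InArea (area f)) (w e)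
      ∉Q⇒upperBound f∉Q y y∈A =
        subst₂ _≤_ (updateAt-updates f w) (updateAt-minimal e f w (≢-sym f≢e))
          (consistent⇒≤ (consistent-updateAt w-consistent y∈A (λ f∈Q → contradiction f∈Q f∉Q)))

      ∈Q : NonTrivial 𝓜 e → U 𝓜 e (w e) → w f ≡ w e → e ∈ Q
      ∈Q e-nontrivial (w-upper , _) wf≡we = decidable-stable (e ∈? Q) λ e∉Q →
        e-nontrivial (bounded⇒trivial w-upper (subst (IsLowerBound _) wf≡we (∉Q⇒lowerBound e∉Q)))

      determined⇒verifies : e ∈ Q → f ∈ Q ⊎ ¬ ¬ Trivial 𝓜 f → w f ≡ w e
                          → Verifies 𝓜 Q (replace Bs f e)
      determined⇒verifies e∈Q f-determined wf≡we v v-consistent =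
        IsMWB-tie (Q-verifies v v-consistent)
          (trans (determined f-determined v-consistent)
            (trans wf≡we (sym (determined (inj₁ e∈Q) v-consistent))))

      -- Raised to w e at e, a weighting consistent with Q - e + f is consistent with Q and
      -- makes the exchanged basis tie with Bs; lowering it back only favours that basis.
      swap⇒verifies : U 𝓜 e (w e) → w f ≡ w e → Verifies 𝓜 (replace Q e f) (replace Bs f e)
      swap⇒verifies (w-upper , _) wf≡we v v-consistent =
        IsMWB-lower (IsMWB-tie (Q-verifies v′ v′-consistent) v′f≡v′e) x∈p∪⁅x⁆
          (subst (v e ≤_) (sym (updateAt-updates e v)) (w-upper (v e) (proj₁ v-consistent e)))
          λ j j≢e → sym (updateAt-minimal j e v j≢e)
        where
          v′ : Fin n → Carrier
          v′ = updateAt v e (const (w e))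

          v′-consistent : Consistent 𝓜 Q v′
          v′-consistent = consistent-updateAt (consistent-⊆ (p⊆p∪q ⁅ f ⁆) v-consistent) (w∈A e) λ _ → refl

          v′f≡v′e : v′ f ≡ v′ e
          v′f≡v′e = trans (updateAt-minimal f e v f≢e)
                      (trans (proj₂ v-consistent f x∈p∪⁅x⁆) (trans wf≡we (sym (updateAt-updates e v))))

      swap-optimal : IsOptimalCertificate 𝓜 Q → e ∈ Q → f ∉ Q → cost f ≤ cost e
                   → U 𝓜 e (w e) → w f ≡ w e → IsOptimalCertificate 𝓜 (replace Q e f)
      swap-optimal (_ , Q-cheapest) e∈Q f∉Q cf≤ce e-max wf≡we =
        (_ , swap⇒verifies e-max wf≡we) ,
        λ Q″ Q″-certificate → ≤-trans (sumOver-replace-≤ cost e∈Q f∉Q cf≤ce) (Q-cheapest Q″ Q″-certificate)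

      optimal-exchange : IsOptimalCertificate 𝓜 Q → w f ≡ w e → U 𝓜 e (w e) → NonTrivial 𝓜 e
                       → (InEU 𝓜 (w e) f → cost f ≤ cost e)
                       → ∃ λ Q′ → IsOptimalCertificate 𝓜 Q′ × Verifies 𝓜 Q′ (replace Bs f e)
      optimal-exchange Q-optimal wf≡we e-max e-nontrivial cost-bound
        with ∈Q e-nontrivial e-max wf≡we | f ∈? Q | weak-excluded-middle (Trivial 𝓜 f)
      ... | e∈Q | yes f∈Q | _ = Q , Q-optimal , determined⇒verifies e∈Q (inj₁ f∈Q) wf≡we
      ... | e∈Q | no _ | inj₂ ¬¬f-trivial = Q , Q-optimal , determined⇒verifies e∈Q (inj₂ ¬¬f-trivial) wf≡we
      ... | e∈Q | no f∉Q | inj₁ f-nontrivial =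
        replace Q e f , swap-optimal Q-optimal e∈Q f∉Q (cost-bound (f-max , f-nontrivial)) e-max wf≡we
                      , swap⇒verifies e-max wf≡we
        where
          f-max : U 𝓜 f (w e)
          f-max = ∉Q⇒upperBound f∉Q , λ b b-bounds → subst (_≤ b) wf≡we (b-bounds (w f) (w∈A f))

lemma3p5 : (R : CompleteOrderedField) {n : ℕ} (𝓜 : WithReals.UMatroid R n)
    (D K B : Subset n) (e : Fin n)
    → WithReals.Compatible R 𝓜 D K
    → e ∈ groundMinor (WithReals.UMatroid.matroid 𝓜) D K
    → WithReals.NonTrivial R 𝓜 e
    → WithReals.IsMWBMinor R 𝓜 D K B
    → e ∈ B
    → WithReals.U R 𝓜 e (WithReals.UMatroid.w 𝓜 e)
    → (∀ f → f ∈ groundMinor (WithReals.UMatroid.matroid 𝓜) D K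
           → ¬ InSpanMinor (WithReals.UMatroid.matroid 𝓜) D K (B - e) f
           → CompleteOrderedField._≤_ R (WithReals.UMatroid.w 𝓜 e) (WithReals.UMatroid.w 𝓜 f))
    → (∀ f → f ∈ groundMinor (WithReals.UMatroid.matroid 𝓜) D K
           → ¬ InSpanMinor (WithReals.UMatroid.matroid 𝓜) D K (B - e) f
           → WithReals.InEU R 𝓜 (WithReals.UMatroid.w 𝓜 e) f
           → CompleteOrderedField._≤_ R (WithReals.UMatroid.cost 𝓜 f) (WithReals.UMatroid.cost 𝓜 e))
    → WithReals.Compatible R 𝓜 D (K ∪ ⁅ e ⁆)
lemma3p5 R 𝓜 D K B e (Q , Bs , Q-optimal , Q-verifies , K⊆Bs , Bs∌D) e∈G e-nontrivial B-mwb e∈B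
         e-max w-minimal cost-maximal with e ∈? Bs
... | yes e∈Bs = Q , Bs , Q-optimal , Q-verifies , ∪⁅⁆-⊆ K⊆Bs e∈Bs , Bs∌D
... | no e∉Bs =
  let (f , f∈Bs , f∉K , f∉span , exchanged-basis) =
        exchange-outside-spanMinor weak-excluded-middle (proj₁ (Q-verifies w w-consistent))
                                   K⊆Bs Bs∌D (proj₁ B-mwb) e∈B e∉Bs
      f∈G = ∈groundMinor⁺ (λ f∈D → Bs∌D f f∈D f∈Bs) f∉K
      open Exchange f∈Bs e∉Bs exchanged-basis
      open Certified Q-verifies
      wf≡we = ≤-antisym (consistent⇒≤ w-consistent) (w-minimal f f∈G f∉span)
      (Q′ , Q′-optimal , Q′-verifies) =
        optimal-exchange Q-optimal wf≡we e-max e-nontrivial (cost-maximal f f∈G f∉span)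
  in Q′ , replace Bs f e , Q′-optimal , Q′-verifies
   , ⊆-replace K⊆Bs f∉K
   , λ g g∈D → ∉-replace (Bs∌D g g∈D) λ { refl → proj₁ (∈groundMinor⁻ e∈G) g∈D }
  where
    open CompleteOrderedFieldProperties R using (weak-excluded-middle; ≤-antisym)
    open MatroidProperties (WithReals.UMatroid.matroid 𝓜)
    open UMatroidProperties R 𝓜
    open WithReals.UMatroid 𝓜 using (w)
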